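{- Let $\Sigma$ be a set, $A=\Sigma\times\Sigma$, and $K=\mathcal{P}(A^\star)$ (sets of finite words over $A$). Let $C\subseteq A^\star$ be the set of consistent words, $\pi:K\to K$ be $\pi(X)=X\cap C$, and $I=\{\langle R\rangle^\star: R\subseteq\Sigma\times\Sigma\}$, where $\langle R\rangle=\{(\sigma,\sigma'): (\sigma,\sigma')\in R\}$ is the language of one-letter words given by the pairs in $R$. Then $(K,I,\cup,\cap,\cdot,\|,{}^\star,\pi,\emptyset,\{\epsilon\})$ is a rely-guarantee algebra with $\pi$, i.e.: $(K,\cup,\cap)$ is a distributive lattice; $(K,\cup,\cdot,\|,\emptyset,\{\epsilon\})$ is a trioid; $(K,\cup,\cdot,\emptyset,\{\epsilon\},{}^\star)$ is a Kleene algebra; $I$ is closed under $\|$ and $\cap$; for all $r,r'\in I$ and $x,y\in K$: $r\|r\subseteq r$, $r\subseteq r\|r'$, $r\|(x\cdot y)=(r\|x)\cdot(r\|y)$, $r\|x^+\subseteq(r\|x)^+$; and for all $x,y,z\in K$: $x^\star\le_\pi\pi(x)^\star$, $x\cdot y\le_\pi\pi(x)\cdot\pi(y)$, $z\cup x\cdot y\le_\pi y\Rightarrow x^\star\cdot z\le_\pi y$, and $z\cup y\cdot x\le_\pi y\Rightarrow z\cdot x^\star\le_\pi y$.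
   Context: A word $(\sigma_1,\sigma_1')(\sigma_2,\sigma_2')\cdots(\sigma_n,\sigma_n')\in A^\star$ is consistent if $\sigma_i'=\sigma_{i+1}$ for all $1\le i<n$ (the empty word and one-letter words are consistent). Language product: $X\cdot Y=\{uv:u\in X,v\in Y\}$; Kleene star $X^\star=\bigcup_{n\ge0}X^n$ with $X^0=\{\epsilon\}$; $X^+=X\cdot X^\star$. Shuffle of words: $\epsilon\|s=\{s\}$, $s\|\epsilon=\{s\}$, $as\|bt=a(s\|bt)\cup b(as\|t)$; of languages: $X\|Y=\bigcup\{x\|y:x\in X,y\in Y\}$. $X\le_\pi Y$ means $\pi(X)\subseteq\pi(Y)$. A dioid is a structure $(S,+,\cdot,0,1)$ with $(S,+,0)$ a commutative monoid, $(S,\cdot,1)$ a monoid, two-sided distributivity, $x\cdot0=0=0\cdot x$, $x+x=x$; a trioid is $(S,+,\cdot,\|,0,1)$ with $(S,+,\cdot,0,1)$ a dioid and $(S,+,\|,0,1)$ a dioid with $\|$ commutative. A Kleene algebra is a dioid with ${}^\star$ satisfying $1+x\cdot x^\star\le x^\star$, $z+x\cdot y\le y\Rightarrow x^\star\cdot z\le y$, $z+y\cdot x\le y\Rightarrow z\cdot x^\star\le y$. -}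

module Defs where

open import Level using (Level; _⊔_) renaming (suc to lsuc; zero to lzero)
open import Data.Nat using (ℕ; zero; suc)
open import Data.List using (List; []; _∷_; _++_; map; [_])
open import Data.List.Membership.Propositional using (_∈_)
open import Data.Product using (Σ; ∃; ∃-syntax; _×_; _,_)
open import Data.Unit using (⊤)
open import Data.Empty using (⊥)
open import Data.Sum using (_⊎_)
open import Relation.Binary.PropositionalEquality using (_≡_)
open import Relation.Binary.Core using (Rel)
open import Algebra.Core using (Op₁; Op₂)
open import Algebra.Definitions using (Idempotent; Commutative)
open import Algebra.Structures using (IsSemiring)
open import Algebra.Lattice.Structures using (IsDistributiveLattice)

module _ {a ℓ : Level} {S : Set a} (_≈_ : Rel S ℓ) where

  _≤[_]_ : S → Op₂ S → S → Set ℓ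
  x ≤[ _+_ ] y = (x + y) ≈ y

  record IsDioid (_+_ _·_ : Op₂ S) (0# 1# : S) : Set (a ⊔ ℓ) where
    field
      isSemiring : IsSemiring _≈_ _+_ _·_ 0# 1#
      +-idem     : Idempotent _≈_ _+_

  record IsTrioid (_+_ _·_ _‖_ : Op₂ S) (0# 1# : S) : Set (a ⊔ ℓ) where
    field
      isDioid-·  : IsDioid _+_ _·_ 0# 1#
      isDioid-‖  : IsDioid _+_ _‖_ 0# 1#
      ‖-comm     : Commutative _≈_ _‖_

  record IsKleeneAlgebra (_+_ _·_ : Op₂ S) (_⋆ : Op₁ S) (0# 1# : S) : Set (a ⊔ ℓ) where
    field
      isDioid    : IsDioid _+_ _·_ 0# 1#
      ⋆-unfold   : ∀ x → (1# + (x · (x ⋆))) ≤[ _+_ ] (x ⋆)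
      ⋆-inductˡ  : ∀ x y z → (z + (x · y)) ≤[ _+_ ] y → ((x ⋆) · z) ≤[ _+_ ] y
      ⋆-inductʳ  : ∀ x y z → (z + (y · x)) ≤[ _+_ ] y → (z · (x ⋆)) ≤[ _+_ ] y

  record IsRGAlgebraπ {i : Level} (I : S → Set i)
           (_+_ _⊓_ _·_ _‖_ : Op₂ S) (_⋆ : Op₁ S) (π : Op₁ S) (0# 1# : S)
           : Set (a ⊔ ℓ ⊔ i) where
    _≤_ : S → S → Set ℓ
    x ≤ y = x ≤[ _+_ ] y
    _≤π_ : S → S → Set ℓ
    x ≤π y = π x ≤ π y
    _⁺ : Op₁ S
    x ⁺ = x · (x ⋆)
    field
      isDistributiveLattice : IsDistributiveLattice _≈_ _+_ _⊓_
      isTrioid              : IsTrioid _+_ _·_ _‖_ 0# 1#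
      isKleeneAlgebra       : IsKleeneAlgebra _+_ _·_ _⋆ 0# 1#
      I-closed-‖            : ∀ r r' → I r → I r' → I (r ‖ r')
      I-closed-⊓            : ∀ r r' → I r → I r' → I (r ⊓ r')
      rely-idem             : ∀ r → I r → (r ‖ r) ≤ r
      rely-incl             : ∀ r r' → I r → I r' → r ≤ (r ‖ r')
      rely-distrib-·        : ∀ r x y → I r → (r ‖ (x · y)) ≈ ((r ‖ x) · (r ‖ y))
      rely-distrib-⁺        : ∀ r x → I r → (r ‖ (x ⁺)) ≤ ((r ‖ x) ⁺)
      π-star                : ∀ x → (x ⋆) ≤π ((π x) ⋆)
      π-prod                : ∀ x y → (x · y) ≤π ((π x) · (π y))
      π-inductˡ             : ∀ x y z → (z + (x · y)) ≤π y → ((x ⋆) · z) ≤π y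
      π-inductʳ             : ∀ x y z → (z + (y · x)) ≤π y → (z · (x ⋆)) ≤π y

module Lang (Sig : Set) where

  A : Set
  A = Sig × Sig

  K : Set₁
  K = List A → Set

  _⊆_ : K → K → Set
  X ⊆ Y = ∀ w → X w → Y w

  _≐_ : K → K → Set
  X ≐ Y = (X ⊆ Y) × (Y ⊆ X)

  ∅ : K
  ∅ w = ⊥

  ｛ε｝ : K
  ｛ε｝ w = w ≡ []

  _∪_ : K → K → K
  (X ∪ Y) w = X w ⊎ Y w

  _∩_ : K → K → K
  (X ∩ Y) w = X w × Y w

  _·_ : K → K → K
  (X · Y) w = ∃[ u ] ∃[ v ] (w ≡ u ++ v × X u × Y v)

  _^_ : K → ℕ → K
  X ^ zero  = ｛ε｝
  X ^ suc n = X · (X ^ n)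

  _⋆ : K → K
  (X ⋆) w = ∃[ n ] (X ^ n) w

  shuffle : List A → List A → List (List A)
  shuffle []       t        = [ t ]
  shuffle (a ∷ s)  []       = [ a ∷ s ]
  shuffle (a ∷ s)  (b ∷ t)  = map (a ∷_) (shuffle s (b ∷ t)) ++ map (b ∷_) (shuffle (a ∷ s) t)

  _‖_ : K → K → K
  (X ‖ Y) w = ∃[ x ] ∃[ y ] (X x × Y y × w ∈ shuffle x y)

  Consistent : List A → Set
  Consistent []                             = ⊤
  Consistent (_ ∷ [])                       = ⊤
  Consistent ((σ₁ , σ₁') ∷ (σ₂ , σ₂') ∷ w)  = (σ₁' ≡ σ₂) × Consistent ((σ₂ , σ₂') ∷ w)

  C : K
  C = Consistent

  π : K → K
  π X = X ∩ C

  ⟨_⟩ : (Sig → Sig → Set) → K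
  ⟨ R ⟩ w = ∃[ σ ] ∃[ σ' ] (w ≡ [ (σ , σ') ] × R σ σ')

  -- I = { ⟨R⟩⋆ : R ⊆ Σ × Σ }  (membership up to set equality)
  I : K → Set₁
  I r = ∃[ R ] (r ≐ (⟨ R ⟩ ⋆))

module Submission where

-- Kleene induction is reduced to induction over the powers X ^ n.
--   * Restriction X ∩ P to a language P closed under prefixes and suffixes
--     (such as the consistent words C) commutes with · and ⋆ up to ⊆;
--     the π-induction laws follow from ordinary Kleene induction applied
--     to the "guarded" language  P ⇒ Y.
--   * A rely language ⟨R⟩⋆ is exactly the set of words all of whose letters
--     lie in R.  Hence I is closed under ‖ and ∩, and every member of I
--     contains ε and is closed under prefixes, suffixes, concatenation and
--     shuffle; the rely laws hold for every language with these properties.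

open import Defs
open import Data.Nat using (zero; suc)
open import Data.List using (List; []; _∷_; _++_; map)
open import Data.List.Properties using (++-assoc; ++-identityʳ)
open import Data.List.Membership.Propositional using (_∈_)
open import Data.List.Membership.Propositional.Properties
  using (∈-map⁺; ∈-map⁻; ∈-++⁺ˡ; ∈-++⁺ʳ; ∈-++⁻)
open import Data.List.Relation.Unary.Any using (here)
open import Data.List.Relation.Unary.All as All using (All; []; _∷_)
open import Data.List.Relation.Unary.All.Properties as All using ()
open import Data.Product using (∃-syntax; _×_; _,_; proj₁; proj₂; uncurry)
open import Data.Sum using (_⊎_; inj₁; inj₂; [_,_])
open import Relation.Binary.PropositionalEquality using (_≡_; refl; sym; cong; subst)
open import Relation.Binary.Bundles using (Setoid)
open import Relation.Binary.Structures using (IsEquivalence)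
open import Relation.Binary.Construct.Union using () renaming (_∪_ to _∪ᴿ_)
open import Relation.Binary.Construct.Intersection using () renaming (_∩_ to _∩ᴿ_)
open import Algebra.Structures using (IsCommutativeMonoid)
open import Algebra.Lattice.Structures using (IsDistributiveLattice)
import Algebra.Lattice.Structures.Biased as LatticeBiased
import Algebra.Consequences.Setoid as Consequences
import Relation.Binary.Reasoning.Setoid as SetoidReasoning

module Shuffle {E : Set} where

  data Sh : List E → List E → List E → Set where
    sh[] : Sh [] [] []
    shˡ  : ∀ {a s t w} → Sh s t w → Sh (a ∷ s) t (a ∷ w)
    shʳ  : ∀ {b s t w} → Sh s t w → Sh s (b ∷ t) (b ∷ w)

  Sh-[]ˡ-intro : ∀ t → Sh [] t t
  Sh-[]ˡ-intro []      = sh[]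
  Sh-[]ˡ-intro (b ∷ t) = shʳ (Sh-[]ˡ-intro t)

  Sh-[]ʳ-intro : ∀ s → Sh s [] s
  Sh-[]ʳ-intro []      = sh[]
  Sh-[]ʳ-intro (a ∷ s) = shˡ (Sh-[]ʳ-intro s)

  Sh-[]ˡ : ∀ {t w} → Sh [] t w → w ≡ t
  Sh-[]ˡ sh[]     = refl
  Sh-[]ˡ (shʳ p) = cong (_ ∷_) (Sh-[]ˡ p)

  Sh-[]ʳ : ∀ {s w} → Sh s [] w → w ≡ s
  Sh-[]ʳ sh[]     = refl
  Sh-[]ʳ (shˡ p) = cong (_ ∷_) (Sh-[]ʳ p)

  Sh-comm : ∀ {s t w} → Sh s t w → Sh t s w
  Sh-comm sh[]     = sh[]
  Sh-comm (shˡ p) = shʳ (Sh-comm p)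
  Sh-comm (shʳ p) = shˡ (Sh-comm p)

  Sh-assocʳ : ∀ {s t u r w} → Sh s t u → Sh u r w → ∃[ v ] (Sh t r v × Sh s v w)
  Sh-assocʳ sh[]     sh[]     = [] , sh[] , sh[]
  Sh-assocʳ (shˡ p) (shˡ q) with Sh-assocʳ p q
  ... | v , tr , sv = v , tr , shˡ sv
  Sh-assocʳ (shʳ p) (shˡ q) with Sh-assocʳ p q
  ... | v , tr , sv = _ ∷ v , shˡ tr , shʳ sv
  Sh-assocʳ p        (shʳ q) with Sh-assocʳ p q
  ... | v , tr , sv = _ ∷ v , shʳ tr , shʳ sv

  Sh-assocˡ : ∀ {s t v r w} → Sh t r v → Sh s v w → ∃[ u ] (Sh s t u × Sh u r w)
  Sh-assocˡ tr sv with Sh-assocʳ (Sh-comm tr) (Sh-comm sv)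
  ... | u , ts , ru = u , Sh-comm ts , Sh-comm ru

  record Splitting (u x y w : List E) : Set where
    constructor splitting
    field
      {u₁ u₂ w₁ w₂} : List E
      u-split : u ≡ u₁ ++ u₂
      w-split : w ≡ w₁ ++ w₂
      left    : Sh u₁ x w₁
      right   : Sh u₂ y w₂

  Sh-split : ∀ x {y u w} → Sh u (x ++ y) w → Splitting u x y w
  Sh-split []      p = splitting refl refl sh[] p
  Sh-split (a ∷ x) (shˡ p) with Sh-split (a ∷ x) p
  ... | splitting refl refl l r = splitting refl refl (shˡ l) r
  Sh-split (a ∷ x) (shʳ p) with Sh-split x p
  ... | splitting refl refl l r = splitting refl refl (shʳ l) r

  Sh-join : ∀ {u₁ x w₁ u₂ y w₂} → Sh u₁ x w₁ → Sh u₂ y w₂ →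
            Sh (u₁ ++ u₂) (x ++ y) (w₁ ++ w₂)
  Sh-join sh[]     q = q
  Sh-join (shˡ p) q = shˡ (Sh-join p q)
  Sh-join (shʳ p) q = shʳ (Sh-join p q)

  All-Sh : ∀ {P : E → Set} {x y w} → All P x → All P y → Sh x y w → All P w
  All-Sh []       []       sh[]     = []
  All-Sh (a ∷ px) py       (shˡ s) = a ∷ All-Sh px py s
  All-Sh px       (b ∷ py) (shʳ s) = b ∷ All-Sh px py s

  All-unSh : ∀ {P Q : E → Set} {w} → All (λ a → P a ⊎ Q a) w →
             ∃[ x ] ∃[ y ] (All P x × All Q y × Sh x y w)
  All-unSh [] = [] , [] , [] , [] , sh[]
  All-unSh (inj₁ pa ∷ pw) with All-unSh pw
  ... | x , y , px , qy , s = _ ∷ x , y , pa ∷ px , qy , shˡ s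
  All-unSh (inj₂ qa ∷ pw) with All-unSh pw
  ... | x , y , px , qy , s = x , _ ∷ y , px , qa ∷ qy , shʳ s

open Shuffle

module Model (Sig : Set) where
  open Lang Sig

  ⊆-trans : ∀ {X Y Z} → X ⊆ Y → Y ⊆ Z → X ⊆ Z
  ⊆-trans f g w x = g w (f w x)

  ≐-isEquivalence : IsEquivalence _≐_
  ≐-isEquivalence = record
    { refl  = (λ _ x → x) , (λ _ x → x)
    ; sym   = λ { (f , g) → g , f }
    ; trans = λ { (f , g) (f' , g') → ⊆-trans f f' , ⊆-trans g' g }
    }

  ≐-setoid : Setoid _ _
  ≐-setoid = record { isEquivalence = ≐-isEquivalence }

  ≤-intro : ∀ {X Y} → X ⊆ Y → (X ∪ Y) ≐ Y
  ≤-intro f = (λ { w (inj₁ x) → f w x ; w (inj₂ y) → y }) , (λ w y → inj₂ y)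

  ≤-elim : ∀ {X Y} → (X ∪ Y) ≐ Y → X ⊆ Y
  ≤-elim e w x = proj₁ e w (inj₁ x)

  open Consequences ≐-setoid using (comm∧idˡ⇒id; comm∧zeˡ⇒ze; comm∧distrˡ⇒distr)

  ∪-comm : ∀ X Y → (X ∪ Y) ≐ (Y ∪ X)
  ∪-comm X Y = swap , swap
    where
    swap : ∀ {X Y} → (X ∪ Y) ⊆ (Y ∪ X)
    swap w = [ inj₂ , inj₁ ]

  ∪-assoc : ∀ X Y Z → ((X ∪ Y) ∪ Z) ≐ (X ∪ (Y ∪ Z))
  ∪-assoc X Y Z =
      (λ { w (inj₁ (inj₁ x)) → inj₁ x ; w (inj₁ (inj₂ y)) → inj₂ (inj₁ y) ; w (inj₂ z) → inj₂ (inj₂ z) })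
    , (λ { w (inj₁ x) → inj₁ (inj₁ x) ; w (inj₂ (inj₁ y)) → inj₁ (inj₂ y) ; w (inj₂ (inj₂ z)) → inj₂ z })

  ∪-cong : ∀ {X X' Y Y'} → X ≐ X' → Y ≐ Y' → (X ∪ Y) ≐ (X' ∪ Y')
  ∪-cong (f , g) (f' , g') =
      (λ { w (inj₁ x) → inj₁ (f w x) ; w (inj₂ y) → inj₂ (f' w y) })
    , (λ { w (inj₁ x) → inj₁ (g w x) ; w (inj₂ y) → inj₂ (g' w y) })

  ∪-idem : ∀ X → (X ∪ X) ≐ X
  ∪-idem X = ≤-intro (λ _ x → x)

  ∪-identityˡ : ∀ X → (∅ ∪ X) ≐ X
  ∪-identityˡ X = (λ { w (inj₂ x) → x }) , (λ w x → inj₂ x)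

  ∩-comm : ∀ X Y → (X ∩ Y) ≐ (Y ∩ X)
  ∩-comm X Y = (λ { w (x , y) → y , x }) , (λ { w (y , x) → x , y })

  ∩-assoc : ∀ X Y Z → ((X ∩ Y) ∩ Z) ≐ (X ∩ (Y ∩ Z))
  ∩-assoc X Y Z = (λ { w ((x , y) , z) → x , (y , z) }) , (λ { w (x , (y , z)) → (x , y) , z })

  ∩-cong : ∀ {X X' Y Y'} → X ≐ X' → Y ≐ Y' → (X ∩ Y) ≐ (X' ∩ Y')
  ∩-cong (f , g) (f' , g') = (λ { w (x , y) → f w x , f' w y }) , (λ { w (x , y) → g w x , g' w y })

  ∪-absorbs-∩ : ∀ X Y → (X ∪ (X ∩ Y)) ≐ X
  ∪-absorbs-∩ X Y = (λ { w (inj₁ x) → x ; w (inj₂ (x , _)) → x }) , (λ w x → inj₁ x)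

  ∩-absorbs-∪ : ∀ X Y → (X ∩ (X ∪ Y)) ≐ X
  ∩-absorbs-∪ X Y = (λ w xy → proj₁ xy) , (λ w x → x , inj₁ x)

  ∪-distribʳ-∩ : ∀ X Y Z → ((Y ∩ Z) ∪ X) ≐ ((Y ∪ X) ∩ (Z ∪ X))
  ∪-distribʳ-∩ X Y Z =
      (λ { w (inj₁ (y , z)) → inj₁ y , inj₁ z ; w (inj₂ x) → inj₂ x , inj₂ x })
    , (λ { w (inj₁ y , inj₁ z) → inj₁ (y , z) ; w (inj₂ x , _) → inj₂ x ; w (_ , inj₂ x) → inj₂ x })

  ∪-∩-isDistributiveLattice : IsDistributiveLattice _≐_ _∪_ _∩_
  ∪-∩-isDistributiveLattice = LatticeBiased.isDistributiveLatticeʳʲᵐ record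
    { isLattice = record
      { isEquivalence = ≐-isEquivalence
      ; ∨-comm        = ∪-comm
      ; ∨-assoc       = ∪-assoc
      ; ∨-cong        = ∪-cong
      ; ∧-comm        = ∩-comm
      ; ∧-assoc       = ∩-assoc
      ; ∧-cong        = ∩-cong
      ; absorptive    = ∪-absorbs-∩ , ∩-absorbs-∪
      }
    ; ∨-distribʳ-∧ = ∪-distribʳ-∩
    }

  ·-monoˡ : ∀ {X X' Y} → X ⊆ X' → (X · Y) ⊆ (X' · Y)
  ·-monoˡ f w (u , v , e , x , y) = u , v , e , f u x , y

  ·-monoʳ : ∀ {X Y Y'} → Y ⊆ Y' → (X · Y) ⊆ (X · Y')
  ·-monoʳ f w (u , v , e , x , y) = u , v , e , x , f v y

  ·-cong : ∀ {X X' Y Y'} → X ≐ X' → Y ≐ Y' → (X · Y) ≐ (X' · Y')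
  ·-cong (f , g) (f' , g') = ⊆-trans (·-monoˡ f) (·-monoʳ f') , ⊆-trans (·-monoˡ g) (·-monoʳ g')

  ·-assoc : ∀ X Y Z → ((X · Y) · Z) ≐ (X · (Y · Z))
  ·-assoc X Y Z =
      (λ { w (_ , v , refl , (u₁ , u₂ , refl , x , y) , z) →
             u₁ , u₂ ++ v , ++-assoc u₁ u₂ v , x , (u₂ , v , refl , y , z) })
    , (λ { w (u , _ , refl , x , (v₁ , v₂ , refl , y , z)) →
             u ++ v₁ , v₂ , sym (++-assoc u v₁ v₂) , (u , v₁ , refl , x , y) , z })

  ·-identityˡ : ∀ X → (｛ε｝ · X) ≐ X
  ·-identityˡ X = (λ { w (_ , _ , refl , refl , x) → x }) , (λ w x → [] , w , refl , refl , x)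

  ·-identityʳ : ∀ X → (X · ｛ε｝) ≐ X
  ·-identityʳ X = (λ { w (u , _ , refl , x , refl) → subst X (sym (++-identityʳ u)) x })
                , (λ w x → w , [] , sym (++-identityʳ w) , x , refl)

  ·-distribˡ : ∀ X Y Z → (X · (Y ∪ Z)) ≐ ((X · Y) ∪ (X · Z))
  ·-distribˡ X Y Z =
      (λ { w (u , v , e , x , inj₁ y) → inj₁ (u , v , e , x , y)
         ; w (u , v , e , x , inj₂ z) → inj₂ (u , v , e , x , z) })
    , (λ { w (inj₁ (u , v , e , x , y)) → u , v , e , x , inj₁ y
         ; w (inj₂ (u , v , e , x , z)) → u , v , e , x , inj₂ z })

  ·-distribʳ : ∀ X Y Z → ((Y ∪ Z) · X) ≐ ((Y · X) ∪ (Z · X))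
  ·-distribʳ X Y Z =
      (λ { w (u , v , e , inj₁ y , x) → inj₁ (u , v , e , y , x)
         ; w (u , v , e , inj₂ z , x) → inj₂ (u , v , e , z , x) })
    , (λ { w (inj₁ (u , v , e , y , x)) → u , v , e , inj₁ y , x
         ; w (inj₂ (u , v , e , z , x)) → u , v , e , inj₂ z , x })

  ∪-isCommutativeMonoid : IsCommutativeMonoid _≐_ _∪_ ∅
  ∪-isCommutativeMonoid = record
    { isMonoid = record
      { isSemigroup = record
        { isMagma = record { isEquivalence = ≐-isEquivalence ; ∙-cong = ∪-cong }
        ; assoc   = ∪-assoc
        }
      ; identity = comm∧idˡ⇒id ∪-comm ∪-identityˡ
      }
    ; comm = ∪-comm
    }

  ·-isDioid : IsDioid _≐_ _∪_ _·_ ∅ ｛ε｝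
  ·-isDioid = record
    { isSemiring = record
      { isSemiringWithoutAnnihilatingZero = record
        { +-isCommutativeMonoid = ∪-isCommutativeMonoid
        ; *-cong     = ·-cong
        ; *-assoc    = ·-assoc
        ; *-identity = ·-identityˡ , ·-identityʳ
        ; distrib    = ·-distribˡ , ·-distribʳ
        }
      ; zero = (λ X → (λ { w (_ , _ , _ , () , _) }) , (λ w ()))
             , (λ X → (λ { w (_ , _ , _ , _ , ()) }) , (λ w ()))
      }
    ; +-idem = ∪-idem
    }

  -- Kleene algebra: the star is the union of the powers, so the induction
  -- laws reduce to induction on the exponent.

  ⋆-unfold : ∀ X → (｛ε｝ ∪ (X · (X ⋆))) ⊆ (X ⋆)
  ⋆-unfold X w (inj₁ e)                        = 0 , e
  ⋆-unfold X w (inj₂ (u , v , e , x , (n , p))) = suc n , u , v , e , x , p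

  power-inductˡ : ∀ {X Y Z} → (Z ∪ (X · Y)) ⊆ Y → ∀ n → ((X ^ n) · Z) ⊆ Y
  power-inductˡ {X} {Y} {Z} h zero    = ⊆-trans (proj₁ (·-identityˡ Z)) (λ w z → h w (inj₁ z))
  power-inductˡ {X} {Y} {Z} h (suc n) =
    ⊆-trans (proj₁ (·-assoc X (X ^ n) Z))
            (⊆-trans (·-monoʳ (power-inductˡ h n)) (λ w xy → h w (inj₂ xy)))

  power-inductʳ : ∀ {X Y Z} → (Z ∪ (Y · X)) ⊆ Y → ∀ n → (Y · (X ^ n)) ⊆ Y
  power-inductʳ {X} {Y} {Z} h zero    = proj₁ (·-identityʳ Y)
  power-inductʳ {X} {Y} {Z} h (suc n) =
    ⊆-trans (proj₂ (·-assoc Y X (X ^ n)))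
            (⊆-trans (·-monoˡ (λ w yx → h w (inj₂ yx))) (power-inductʳ h n))

  ⋆-inductˡ-⊆ : ∀ {X Y Z} → (Z ∪ (X · Y)) ⊆ Y → ((X ⋆) · Z) ⊆ Y
  ⋆-inductˡ-⊆ h w (u , v , e , (n , p) , z) = power-inductˡ h n w (u , v , e , p , z)

  ⋆-inductʳ-⊆ : ∀ {X Y Z} → (Z ∪ (Y · X)) ⊆ Y → (Z · (X ⋆)) ⊆ Y
  ⋆-inductʳ-⊆ h w (u , v , e , z , (n , p)) =
    power-inductʳ h n w (u , v , e , h u (inj₁ z) , p)

  isKleeneAlgebra : IsKleeneAlgebra _≐_ _∪_ _·_ _⋆ ∅ ｛ε｝
  isKleeneAlgebra = record
    { isDioid   = ·-isDioid
    ; ⋆-unfold  = λ X → ≤-intro (⋆-unfold X)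
    ; ⋆-inductˡ = λ X Y Z e → ≤-intro (⋆-inductˡ-⊆ (≤-elim e))
    ; ⋆-inductʳ = λ X Y Z e → ≤-intro (⋆-inductʳ-⊆ (≤-elim e))
    }

  -- (K, ∪, ‖, ∅, ｛ε｝) is a commutative dioid.  The list-valued shuffle of
  -- the definition is first identified with the relation Sh.

  shuffle⇒Sh : ∀ s t {w} → w ∈ shuffle s t → Sh s t w
  shuffle⇒Sh []      t       (here refl) = Sh-[]ˡ-intro t
  shuffle⇒Sh (a ∷ s) []      (here refl) = Sh-[]ʳ-intro (a ∷ s)
  shuffle⇒Sh (a ∷ s) (b ∷ t) m with ∈-++⁻ (map (a ∷_) (shuffle s (b ∷ t))) m
  ... | inj₁ m₁ with ∈-map⁻ (a ∷_) m₁
  ...   | _ , m' , refl = shˡ (shuffle⇒Sh s (b ∷ t) m')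
  shuffle⇒Sh (a ∷ s) (b ∷ t) m | inj₂ m₂ with ∈-map⁻ (b ∷_) m₂
  ...   | _ , m' , refl = shʳ (shuffle⇒Sh (a ∷ s) t m')

  Sh⇒shuffle : ∀ {s t w} → Sh s t w → w ∈ shuffle s t
  Sh⇒shuffle sh[] = here refl
  Sh⇒shuffle (shˡ {a} {s} {[]} p) with Sh-[]ʳ p
  ... | refl = here refl
  Sh⇒shuffle (shˡ {a} {s} {b ∷ t} p) = ∈-++⁺ˡ (∈-map⁺ (a ∷_) (Sh⇒shuffle p))
  Sh⇒shuffle (shʳ {b} {[]} p) with Sh-[]ˡ p
  ... | refl = here refl
  Sh⇒shuffle (shʳ {b} {a ∷ s} {t} p) =
    ∈-++⁺ʳ (map (a ∷_) (shuffle s (b ∷ t))) (∈-map⁺ (b ∷_) (Sh⇒shuffle p))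

  ‖-intro : ∀ {X Y : K} {x y w} → X x → Y y → Sh x y w → (X ‖ Y) w
  ‖-intro {x = x} {y} px py s = x , y , px , py , Sh⇒shuffle s

  ‖-mono : ∀ {X X' Y Y'} → X ⊆ X' → Y ⊆ Y' → (X ‖ Y) ⊆ (X' ‖ Y')
  ‖-mono f g w (x , y , px , py , m) = x , y , f x px , g y py , m

  ‖-cong : ∀ {X X' Y Y'} → X ≐ X' → Y ≐ Y' → (X ‖ Y) ≐ (X' ‖ Y')
  ‖-cong (f , g) (f' , g') = ‖-mono f f' , ‖-mono g g'

  ‖-comm : ∀ X Y → (X ‖ Y) ≐ (Y ‖ X)
  ‖-comm X Y = swap , swap
    where
    swap : ∀ {X Y} → (X ‖ Y) ⊆ (Y ‖ X)
    swap w (x , y , px , py , m) = ‖-intro py px (Sh-comm (shuffle⇒Sh x y m))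

  ‖-assoc : ∀ X Y Z → ((X ‖ Y) ‖ Z) ≐ (X ‖ (Y ‖ Z))
  ‖-assoc X Y Z = reassocʳ , reassocˡ
    where
    reassocʳ : ((X ‖ Y) ‖ Z) ⊆ (X ‖ (Y ‖ Z))
    reassocʳ w (u , z , (x , y , px , py , m₁) , pz , m₂)
      with Sh-assocʳ (shuffle⇒Sh x y m₁) (shuffle⇒Sh u z m₂)
    ... | v , yz , xv = ‖-intro px (‖-intro {X = Y} {Y = Z} py pz yz) xv
    reassocˡ : (X ‖ (Y ‖ Z)) ⊆ ((X ‖ Y) ‖ Z)
    reassocˡ w (x , v , px , (y , z , py , pz , m₁) , m₂)
      with Sh-assocˡ (shuffle⇒Sh y z m₁) (shuffle⇒Sh x v m₂)
    ... | u , xy , uz = ‖-intro (‖-intro {X = X} {Y = Y} px py xy) pz uz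

  ‖-identityˡ : ∀ X → (｛ε｝ ‖ X) ≐ X
  ‖-identityˡ X = (λ { w (_ , y , refl , py , m) → subst X (sym (Sh-[]ˡ (shuffle⇒Sh [] y m))) py })
                , (λ w p → ‖-intro {X = ｛ε｝} refl p (Sh-[]ˡ-intro w))

  ‖-distribˡ : ∀ X Y Z → (X ‖ (Y ∪ Z)) ≐ ((X ‖ Y) ∪ (X ‖ Z))
  ‖-distribˡ X Y Z =
      (λ { w (u , v , x , inj₁ y , m) → inj₁ (u , v , x , y , m)
         ; w (u , v , x , inj₂ z , m) → inj₂ (u , v , x , z , m) })
    , (λ { w (inj₁ (u , v , x , y , m)) → u , v , x , inj₁ y , m
         ; w (inj₂ (u , v , x , z , m)) → u , v , x , inj₂ z , m })

  ‖-isDioid : IsDioid _≐_ _∪_ _‖_ ∅ ｛ε｝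
  ‖-isDioid = record
    { isSemiring = record
      { isSemiringWithoutAnnihilatingZero = record
        { +-isCommutativeMonoid = ∪-isCommutativeMonoid
        ; *-cong     = ‖-cong
        ; *-assoc    = ‖-assoc
        ; *-identity = comm∧idˡ⇒id ‖-comm ‖-identityˡ
        ; distrib    = comm∧distrˡ⇒distr ∪-cong ‖-comm ‖-distribˡ
        }
      ; zero = comm∧zeˡ⇒ze ‖-comm (λ X → (λ { w (_ , _ , () , _) }) , (λ w ()))
      }
    ; +-idem = ∪-idem
    }

  isTrioid : IsTrioid _≐_ _∪_ _·_ _‖_ ∅ ｛ε｝
  isTrioid = record { isDioid-· = ·-isDioid ; isDioid-‖ = ‖-isDioid ; ‖-comm = ‖-comm }

  PrefixClosed : K → Set
  PrefixClosed P = ∀ u v → P (u ++ v) → P u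

  SuffixClosed : K → Set
  SuffixClosed P = ∀ u v → P (u ++ v) → P v

  C-prefixClosed : PrefixClosed C
  C-prefixClosed []                    v c       = _
  C-prefixClosed (a ∷ [])              v c       = _
  C-prefixClosed (a ∷ b ∷ u)           v (e , c) = e , C-prefixClosed (b ∷ u) v c

  C-suffixClosed : SuffixClosed C
  C-suffixClosed []          v       c       = c
  C-suffixClosed (a ∷ [])    []      c       = _
  C-suffixClosed (a ∷ [])    (b ∷ v) (e , c) = c
  C-suffixClosed (a ∷ b ∷ u) v       (e , c) = C-suffixClosed (b ∷ u) v c

  module Restriction {P : K} (prefix : PrefixClosed P) (suffix : SuffixClosed P) where

    restrict-· : ∀ {X Y} → ((X · Y) ∩ P) ⊆ ((X ∩ P) · (Y ∩ P))
    restrict-· w ((u , v , refl , x , y) , p) = u , v , refl , (x , prefix u v p) , (y , suffix u v p)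

    restrict-^ : ∀ {X} n → ((X ^ n) ∩ P) ⊆ ((X ∩ P) ^ n)
    restrict-^ zero    w (e , _) = e
    restrict-^ (suc n) w xp =
      ·-monoʳ (restrict-^ n) w (restrict-· w xp)

    restrict-⋆ : ∀ {X} → ((X ⋆) ∩ P) ⊆ ((X ∩ P) ⋆)
    restrict-⋆ w ((n , x) , p) = n , restrict-^ n w (x , p)

  _⇒_ : K → K → K
  (P ⇒ Y) w = P w → Y w

  -- Kleene induction relative to P: the hypothesis is only required on
  -- P-words, and the guarded language P ⇒ Y satisfies the unrestricted
  -- hypothesis because membership in P passes to suffixes (resp. prefixes).
  restrict-inductˡ : ∀ {P X Y Z} → SuffixClosed P →
                     ((Z ∪ (X · Y)) ∩ P) ⊆ Y → (((X ⋆) · Z) ∩ P) ⊆ Y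
  restrict-inductˡ {P} {X} {Y} {Z} suffix h w (xz , p) = ⋆-inductˡ-⊆ guarded w xz p
    where
    guarded : (Z ∪ (X · (P ⇒ Y))) ⊆ (P ⇒ Y)
    guarded w (inj₁ z) p = h w (inj₁ z , p)
    guarded _ (inj₂ (u , v , refl , x , g)) p = h (u ++ v) (inj₂ (u , v , refl , x , g (suffix u v p)) , p)

  restrict-inductʳ : ∀ {P X Y Z} → PrefixClosed P →
                     ((Z ∪ (Y · X)) ∩ P) ⊆ Y → ((Z · (X ⋆)) ∩ P) ⊆ Y
  restrict-inductʳ {P} {X} {Y} {Z} prefix h w (zx , p) = ⋆-inductʳ-⊆ guarded w zx p
    where
    guarded : (Z ∪ ((P ⇒ Y) · X)) ⊆ (P ⇒ Y)
    guarded w (inj₁ z) p = h w (inj₁ z , p)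
    guarded _ (inj₂ (u , v , refl , g , x)) p = h (u ++ v) (inj₂ (u , v , refl , g (prefix u v p) , x) , p)

  π-≤-intro : ∀ {X Y} → (X ∩ C) ⊆ Y → (π X ∪ π Y) ≐ π Y
  π-≤-intro f = ≤-intro (λ w xc → f w xc , proj₂ xc)

  π-≤-elim : ∀ {X Y} → (π X ∪ π Y) ≐ π Y → (X ∩ C) ⊆ Y
  π-≤-elim e w xc = proj₁ (≤-elim e w xc)

  Steps : (Sig → Sig → Set) → K
  Steps R = All (uncurry R)

  ⟨⟩^⊆Steps : ∀ R n → (⟨ R ⟩ ^ n) ⊆ Steps R
  ⟨⟩^⊆Steps R zero    _ refl = []
  ⟨⟩^⊆Steps R (suc n) _ (_ , v , refl , (_ , _ , refl , r) , p) = r ∷ ⟨⟩^⊆Steps R n v p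

  Steps⊆⟨⟩⋆ : ∀ R → Steps R ⊆ (⟨ R ⟩ ⋆)
  Steps⊆⟨⟩⋆ R []      []       = 0 , refl
  Steps⊆⟨⟩⋆ R (a ∷ w) (r ∷ rs) with Steps⊆⟨⟩⋆ R w rs
  ... | n , p = suc n , a ∷ [] , w , refl , (_ , _ , refl , r) , p

  ⟨⟩⋆≐Steps : ∀ R → (⟨ R ⟩ ⋆) ≐ Steps R
  ⟨⟩⋆≐Steps R = (λ { w (n , p) → ⟨⟩^⊆Steps R n w p }) , Steps⊆⟨⟩⋆ R

  Steps-‖ : ∀ R R' → (Steps R ‖ Steps R') ≐ Steps (R ∪ᴿ R')
  Steps-‖ R R' =
      (λ { w (x , y , rx , ry , m) →
             All-Sh (All.map inj₁ rx) (All.map inj₂ ry) (shuffle⇒Sh x y m) })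
    , (λ { w rw → let (x , y , rx , ry , s) = All-unSh rw in ‖-intro {X = Steps R} {Y = Steps R'} rx ry s })

  Steps-∩ : ∀ R R' → (Steps R ∩ Steps R') ≐ Steps (R ∩ᴿ R')
  Steps-∩ R R' = (λ w → All.zip) , (λ w → All.unzip)

  I-closed-‖ : ∀ {r r'} → I r → I r' → I (r ‖ r')
  I-closed-‖ {r} {r'} (R , r≐) (R' , r'≐) = R ∪ᴿ R' , (begin
    r ‖ r'                   ≈⟨ ‖-cong r≐ r'≐ ⟩
    (⟨ R ⟩ ⋆) ‖ (⟨ R' ⟩ ⋆)   ≈⟨ ‖-cong (⟨⟩⋆≐Steps R) (⟨⟩⋆≐Steps R') ⟩
    Steps R ‖ Steps R'       ≈⟨ Steps-‖ R R' ⟩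
    Steps (R ∪ᴿ R')          ≈⟨ ⟨⟩⋆≐Steps (R ∪ᴿ R') ⟨
    ⟨ R ∪ᴿ R' ⟩ ⋆            ∎)
    where open SetoidReasoning ≐-setoid

  I-closed-∩ : ∀ {r r'} → I r → I r' → I (r ∩ r')
  I-closed-∩ {r} {r'} (R , r≐) (R' , r'≐) = R ∩ᴿ R' , (begin
    r ∩ r'                   ≈⟨ ∩-cong r≐ r'≐ ⟩
    (⟨ R ⟩ ⋆) ∩ (⟨ R' ⟩ ⋆)   ≈⟨ ∩-cong (⟨⟩⋆≐Steps R) (⟨⟩⋆≐Steps R') ⟩
    Steps R ∩ Steps R'       ≈⟨ Steps-∩ R R' ⟩
    Steps (R ∩ᴿ R')          ≈⟨ ⟨⟩⋆≐Steps (R ∩ᴿ R') ⟨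
    ⟨ R ∩ᴿ R' ⟩ ⋆            ∎)
    where open SetoidReasoning ≐-setoid

  record IsRely (r : K) : Set where
    field
      ε∈            : r []
      prefixClosed  : PrefixClosed r
      suffixClosed  : SuffixClosed r
      concatClosed  : ∀ u v → r u → r v → r (u ++ v)
      shuffleClosed : ∀ {x y w} → r x → r y → Sh x y w → r w

  I⇒IsRely : ∀ {r} → I r → IsRely r
  I⇒IsRely {r} (R , r≐) = record
    { ε∈            = from [] []
    ; prefixClosed  = λ u v ruv → from u (All.++⁻ˡ u (to (u ++ v) ruv))
    ; suffixClosed  = λ u v ruv → from v (All.++⁻ʳ u (to (u ++ v) ruv))
    ; concatClosed  = λ u v ru rv → from (u ++ v) (All.++⁺ (to u ru) (to v rv))
    ; shuffleClosed = λ {x} {y} {w} rx ry s → from w (All-Sh (to x rx) (to y ry) s)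
    }
    where
    to : r ⊆ Steps R
    to = ⊆-trans (proj₁ r≐) (proj₁ (⟨⟩⋆≐Steps R))
    from : Steps R ⊆ r
    from = ⊆-trans (proj₂ (⟨⟩⋆≐Steps R)) (proj₂ r≐)

  module Rely {r : K} (isRely : IsRely r) where
    open IsRely isRely

    rely-idem : (r ‖ r) ⊆ r
    rely-idem w (x , y , rx , ry , m) = shuffleClosed rx ry (shuffle⇒Sh x y m)

    rely-incl : ∀ {r'} → r' ⊆ (r' ‖ r)
    rely-incl {r'} w p = ‖-intro {X = r'} {Y = r} p ε∈ (Sh-[]ʳ-intro w)

    -- An interleaving of a rely word with x ++ y splits at the border of x and y.
    rely-distrib-⊆ : ∀ {X Y} → (r ‖ (X · Y)) ⊆ ((r ‖ X) · (r ‖ Y))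
    rely-distrib-⊆ {X} {Y} w (u , _ , ru , (x , y , refl , px , py) , m)
      with Sh-split x (shuffle⇒Sh u (x ++ y) m)
    ... | splitting {u₁} {u₂} {w₁} {w₂} refl refl l r' =
      w₁ , w₂ , refl ,
      ‖-intro {X = r} {Y = X} (prefixClosed u₁ u₂ ru) px l ,
      ‖-intro {X = r} {Y = Y} (suffixClosed u₁ u₂ ru) py r'

    rely-distrib-⊇ : ∀ {X Y} → ((r ‖ X) · (r ‖ Y)) ⊆ (r ‖ (X · Y))
    rely-distrib-⊇ {X} {Y} _ (_ , _ , refl , (u₁ , x , ru₁ , px , m₁) , (u₂ , y , ru₂ , py , m₂)) =
      ‖-intro {X = r} {Y = X · Y} (concatClosed u₁ u₂ ru₁ ru₂) (x , y , refl , px , py)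
              (Sh-join (shuffle⇒Sh u₁ x m₁) (shuffle⇒Sh u₂ y m₂))

    rely-distrib : ∀ X Y → (r ‖ (X · Y)) ≐ ((r ‖ X) · (r ‖ Y))
    rely-distrib X Y = rely-distrib-⊆ , rely-distrib-⊇

    rely-power : ∀ {X} n → (r ‖ (X ^ suc n)) ⊆ ((r ‖ X) ^ suc n)
    rely-power {X} zero =
      ⊆-trans (‖-mono {X = r} (λ _ x → x) (proj₁ (·-identityʳ X)))
              (proj₂ (·-identityʳ (r ‖ X)))
    rely-power {X} (suc n) = ⊆-trans rely-distrib-⊆ (·-monoʳ (rely-power n))

    rely-⁺ : ∀ {X} → (r ‖ (X · (X ⋆))) ⊆ ((r ‖ X) · ((r ‖ X) ⋆))
    rely-⁺ {X} w (u , z , ru , (x , v , e , px , (n , pn)) , m) =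
      ·-monoʳ (λ _ p → n , p) w (rely-power n w (u , z , ru , (x , v , e , px , pn) , m))

theorem7 : (Sig : Set) → let open Lang Sig in
    IsRGAlgebraπ _≐_ I _∪_ _∩_ _·_ _‖_ _⋆ π ∅ ｛ε｝
theorem7 Sig = record
  { isDistributiveLattice = ∪-∩-isDistributiveLattice
  ; isTrioid              = isTrioid
  ; isKleeneAlgebra       = isKleeneAlgebra
  ; I-closed-‖            = λ _ _ → I-closed-‖
  ; I-closed-⊓            = λ _ _ → I-closed-∩
  ; rely-idem             = λ _ ir → ≤-intro (Rely.rely-idem (I⇒IsRely ir))
  ; rely-incl             = λ _ _ _ ir' → ≤-intro (Rely.rely-incl (I⇒IsRely ir'))
  ; rely-distrib-·        = λ _ x y ir → Rely.rely-distrib (I⇒IsRely ir) x y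
  ; rely-distrib-⁺        = λ _ _ ir → ≤-intro (Rely.rely-⁺ (I⇒IsRely ir))
  ; π-star                = λ _ → π-≤-intro restrict-⋆
  ; π-prod                = λ _ _ → π-≤-intro restrict-·
  ; π-inductˡ             = λ _ _ _ h → π-≤-intro (restrict-inductˡ C-suffixClosed (π-≤-elim h))
  ; π-inductʳ             = λ _ _ _ h → π-≤-intro (restrict-inductʳ C-prefixClosed (π-≤-elim h))
  }
  where
  open Model Sig
  open Restriction C-prefixClosed C-suffixClosed
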